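{- Let $T$ be a tree on vertex set $[n]$ and let $X(T)$ be the number of paths in $T$ of even edge-length at least $2$. Then $X(T)\ge X(P_n)$, where $P_n$ is a path on $[n]$, and $X(P_n)=\left\lceil\frac{n(n-2)}{4}\right\rceil$. -}

module Defs where

open import Data.Bool using (Bool; true; false; T; _∧_; _∨_; not; if_then_else_)
open import Data.Nat using (ℕ; zero; suc; _+_; _*_; _∸_; _≤_; _%_; _≡ᵇ_; _<ᵇ_; _≤ᵇ_)

open import Data.Fin using (Fin; toℕ; _≟_)
open import Data.List using (List; []; _∷_; length; map; concatMap; filterᵇ; allFin; upTo)
open import Data.Nat.ListAction using (sum)
open import Data.Product using (Σ; ∃; _×_; _,_)
open import Data.Empty using (⊥)
open import Relation.Nullary.Decidable using (does)
open import Relation.Binary.PropositionalEquality using (_≡_; refl)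

record Graph (n : ℕ) : Set where
  field
    adj    : Fin n → Fin n → Bool
    symm   : ∀ i j → adj i j ≡ adj j i
    irrefl : ∀ i → adj i i ≡ false
open Graph public

module _ {n : ℕ} (G : Graph n) where

  isWalk : List (Fin n) → Bool
  isWalk []           = true
  isWalk (x ∷ [])     = true
  isWalk (x ∷ y ∷ xs) = adj G x y ∧ isWalk (y ∷ xs)

elemᵇ : ∀ {n} → Fin n → List (Fin n) → Bool
elemᵇ x []       = false
elemᵇ x (y ∷ ys) = does (x ≟ y) ∨ elemᵇ x ys

distinct : ∀ {n} → List (Fin n) → Bool
distinct []       = true
distinct (x ∷ xs) = not (elemᵇ x xs) ∧ distinct xs

lastFrom : ∀ {n} → Fin n → List (Fin n) → Fin n
lastFrom u []       = u
lastFrom u (x ∷ xs) = lastFrom x xs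

module _ {n : ℕ} (G : Graph n) where

  isPath : List (Fin n) → Bool
  isPath p = distinct p ∧ isWalk G p

  Connected : Set
  Connected = ∀ (u v : Fin n) →
    ∃ λ (w : List (Fin n)) → T (isWalk G (u ∷ w)) × lastFrom u w ≡ v

  Acyclic : Set
  Acyclic = ∀ (u : Fin n) (w : List (Fin n)) →
    3 ≤ length (u ∷ w) → T (isPath (u ∷ w)) → T (adj G (lastFrom u w) u) → ⊥

record Tree (n : ℕ) : Set where
  field
    graph     : Graph n
    connected : Connected graph
    acyclic   : Acyclic graph
open Tree public

tuples : (n m : ℕ) → List (List (Fin n))
tuples n zero    = [] ∷ []
tuples n (suc m) = concatMap (λ x → map (x ∷_) (tuples n m)) (allFin n)

-- A path (subgraph) is its vertex sequence up to reversal; we pick the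
-- representative whose first vertex has smaller label than its last one.
canonical : ∀ {n} → List (Fin n) → Bool
canonical []       = false
canonical (u ∷ w)  = toℕ u <ᵇ toℕ (lastFrom u w)

numPaths : ∀ {n} → Graph n → ℕ → ℕ
numPaths {n} G k = length (filterᵇ (λ p → isPath G p ∧ canonical p) (tuples n (suc k)))

-- X(G): number of paths of even edge-length at least 2
-- (edge-lengths of paths in a graph on n vertices are at most n - 1)
X : ∀ {n} → Graph n → ℕ
X {n} G = sum (map (λ k → if (k % 2 ≡ᵇ 0) ∧ (2 ≤ᵇ k) then numPaths G k else 0) (upTo n))

pathAdj : ∀ {n} → Fin n → Fin n → Bool
pathAdj i j = (suc (toℕ i) ≡ᵇ toℕ j) ∨ (suc (toℕ j) ≡ᵇ toℕ i)

private
  ∨-comm : ∀ a b → a ∨ b ≡ b ∨ a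
  ∨-comm false false = refl
  ∨-comm false true  = refl
  ∨-comm true  false = refl
  ∨-comm true  true  = refl

  suc≢ : ∀ m → (suc m ≡ᵇ m) ≡ false
  suc≢ zero    = refl
  suc≢ (suc m) = suc≢ m

pathAdj-irrefl : ∀ {n} (i : Fin n) → pathAdj i i ≡ false
pathAdj-irrefl i rewrite suc≢ (toℕ i) = refl

P : (n : ℕ) → Graph n
P n = record
  { adj    = pathAdj
  ; symm   = λ i j → ∨-comm (suc (toℕ i) ≡ᵇ toℕ j) (suc (toℕ j) ≡ᵇ toℕ i)
  ; irrefl = pathAdj-irrefl
  }

ceil4 : ℕ → ℕ
ceil4 m = Data.Nat._/_ (m + 3) 4

-- Colour each vertex of T by the parity of its distance from a root, so that adjacent vertices
-- get different colours. Along any walk the colour flips at every step, and T has exactly one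
-- path between any two vertices; hence that path has even length iff its ends have the same
-- colour, and X(T) = C(a,2) + C(b,2) where a + b = n are the sizes of the colour classes. Then
-- 2 X(T) + n = a² + b² ≥ n²/2, with equality up to rounding when |a − b| ≤ 1, which is the case
-- for Pₙ coloured by the parity of the labels.
module Submission where

open import Defs
open import Data.Nat.Properties hiding (_≟_)
open import Algebra.Properties.CommutativeMonoid.Sum +-0-commutativeMonoid
  using (sum-syntax; ∑-comm; ∑-distrib-+; sum-cong-≗; sum-replicate-zero) renaming (sum to ∑)
open import Data.Bool using (Bool; true; false; T; _∧_; not; if_then_else_)
open import Data.Bool.Properties using (not-involutive; ∧-identityʳ; T-≡; T-∧; T-∨)
open import Data.Empty using (⊥-elim)
open import Data.Fin using (Fin; toℕ; _≟_; fromℕ<) renaming (zero to fz; suc to fs)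
open import Data.Fin.Properties using (toℕ-injective; toℕ-fromℕ<; toℕ<n) renaming (suc-injective to fs-injective)
open import Data.List using (List; []; _∷_; length; map; concatMap; filterᵇ; tabulate; allFin; applyUpTo; _++_)
open import Data.List.Properties using (length-++; filter-++; ∷-injectiveˡ; ∷-injectiveʳ)
open import Data.Nat using (ℕ; zero; suc; _+_; _*_; _∸_; _≤_; _<_; _%_; _≡ᵇ_; _<ᵇ_; _≤ᵇ_; z≤n; s≤s; z<s)
open import Data.Nat.DivMod using (m*n/n≡m; /-monoˡ-≤; m<n*o⇒m/o<n)
open import Data.Nat.ListAction using (sum)
open import Data.Nat.Solver using (module +-*-Solver)
open +-*-Solver using (solve; _:+_; _:*_; _:=_; con)
open import Data.Product using (∃; _×_; _,_; proj₁; proj₂)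
open import Data.Sum using (_⊎_; inj₁; inj₂)
open import Data.Unit using (⊤; tt)
open import Function using (_∘_; id; case_of_; Equivalence)
open import Relation.Nullary using (¬_; yes; no; does)
open import Relation.Nullary.Decidable using (T?; dec-true; dec-false)
open import Relation.Binary.PropositionalEquality

∧-intro : ∀ {a b} → T a → T b → T (a ∧ b)
∧-intro p q = Equivalence.from T-∧ (p , q)

∧-fst : ∀ {a b} → T (a ∧ b) → T a
∧-fst = proj₁ ∘ Equivalence.to T-∧

∧-snd : ∀ {a b} → T (a ∧ b) → T b
∧-snd = proj₂ ∘ Equivalence.to T-∧

T-not⁺ : ∀ {a} → ¬ T a → T (not a)
T-not⁺ {true}  ¬a = ¬a tt
T-not⁺ {false} _  = tt

T-not⁻ : ∀ {a} → T (not a) → ¬ T a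
T-not⁻ {true} ()

T⇒≡true : ∀ {a} → T a → a ≡ true
T⇒≡true = Equivalence.to T-≡

≡true⇒T : ∀ {a} → a ≡ true → T a
≡true⇒T = Equivalence.from T-≡

≟⇒≡ : ∀ {n} (x y : Fin n) → T (does (x ≟ y)) → x ≡ y
≟⇒≡ x y _ with x ≟ y
... | yes x≡y = x≡y

≡⇒≟ : ∀ {n} (x y : Fin n) → x ≡ y → T (does (x ≟ y))
≡⇒≟ x y x≡y rewrite dec-true (x ≟ y) x≡y = tt

if-same : ∀ {A : Set} b (x : A) → (if b then x else x) ≡ x
if-same true  x = refl
if-same false x = refl

ind : Bool → ℕ
ind b = if b then 1 else 0

∑-mono-≤ : ∀ {n} {f g : Fin n → ℕ} → (∀ i → f i ≤ g i) → ∑ f ≤ ∑ g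
∑-mono-≤ {zero}  f≤g = z≤n
∑-mono-≤ {suc n} f≤g = +-mono-≤ (f≤g fz) (∑-mono-≤ (f≤g ∘ fs))

∑-zero : ∀ {n} {f : Fin n → ℕ} → (∀ i → f i ≡ 0) → ∑ f ≡ 0
∑-zero {n} f≡0 = trans (sum-cong-≗ f≡0) (sum-replicate-zero n)

∑-one : ∀ n → ∑[ i < n ] 1 ≡ n
∑-one zero    = refl
∑-one (suc n) = cong suc (∑-one n)

∑-single : ∀ {n} (f : Fin n → ℕ) i → (∀ j → j ≢ i → f j ≡ 0) → ∑ f ≡ f i
∑-single f fz     f≡0 = trans (cong (f fz +_) (∑-zero λ j → f≡0 (fs j) λ ())) (+-identityʳ _)
∑-single f (fs i) f≡0 =
  trans (cong (_+ ∑ (f ∘ fs)) (f≡0 fz λ ()))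
        (∑-single (f ∘ fs) i λ j j≢i → f≡0 (fs j) (j≢i ∘ fs-injective))

∑-if : ∀ {n} b (f : Fin n → ℕ) → (if b then ∑ f else 0) ≡ ∑[ i < n ] (if b then f i else 0)
∑-if {n} true  f = refl
∑-if {n} false f = sym (sum-replicate-zero n)

sum-applyUpTo : ∀ (f g : ℕ → ℕ) n → sum (map f (applyUpTo g n)) ≡ ∑[ i < n ] f (g (toℕ i))
sum-applyUpTo f g zero    = refl
sum-applyUpTo f g (suc n) = cong (f (g 0) +_) (sum-applyUpTo f (g ∘ suc) n)

∑-indicator : ∀ {n} b (i : Fin n) → ∑[ j < n ] ind (b ∧ does (i ≟ j)) ≡ ind b
∑-indicator {n} false i = sum-replicate-zero n
∑-indicator     true  i = trans (∑-single _ i λ j j≢i → cong ind (dec-false (i ≟ j) (j≢i ∘ sym)))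
                                (cong ind (dec-true (i ≟ i) refl))

∑-≡ᵇ : ∀ {n} (e : ℕ → Bool) {d} → d < n → ∑[ k < n ] (if e (toℕ k) then ind (d ≡ᵇ toℕ k) else 0) ≡ ind (e d)
∑-≡ᵇ {n} e {d} d<n = begin
  ∑[ k < n ] (if e (toℕ k) then ind (d ≡ᵇ toℕ k) else 0)  ≡⟨ ∑-single _ k₀ off-k₀ ⟩
  (if e (toℕ k₀) then ind (d ≡ᵇ toℕ k₀) else 0)          ≡⟨ cong (λ j → if e j then ind (d ≡ᵇ j) else 0) (toℕ-fromℕ< d<n) ⟩
  (if e d then ind (d ≡ᵇ d) else 0)                      ≡⟨ cong (λ b → if e d then ind b else 0) (T⇒≡true (≡⇒≡ᵇ d d refl)) ⟩
  ind (e d)                                              ∎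
  where
  open ≡-Reasoning
  k₀ : Fin n
  k₀ = fromℕ< d<n
  off-k₀ : ∀ k → k ≢ k₀ → (if e (toℕ k) then ind (d ≡ᵇ toℕ k) else 0) ≡ 0
  off-k₀ k k≢k₀ with d ≡ᵇ toℕ k in d≡k
  ... | true  = ⊥-elim (k≢k₀ (toℕ-injective (trans (sym (≡ᵇ⇒≡ d (toℕ k) (≡true⇒T d≡k))) (sym (toℕ-fromℕ< d<n)))))
  ... | false = if-same (e (toℕ k)) 0

sum-map-tabulate : ∀ {A : Set} {n} (f : A → ℕ) (g : Fin n → A) → sum (map f (tabulate g)) ≡ ∑ (f ∘ g)
sum-map-tabulate {n = zero}  f g = refl
sum-map-tabulate {n = suc n} f g = cong (f (g fz) +_) (sum-map-tabulate f (g ∘ fs))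

countᵇ : ∀ {A : Set} → (A → Bool) → List A → ℕ
countᵇ p xs = length (filterᵇ p xs)

countᵇ-∷ : ∀ {A : Set} (p : A → Bool) x xs → countᵇ p (x ∷ xs) ≡ ind (p x) + countᵇ p xs
countᵇ-∷ p x xs with p x
... | true  = refl
... | false = refl

countᵇ-++ : ∀ {A : Set} (p : A → Bool) xs ys → countᵇ p (xs ++ ys) ≡ countᵇ p xs + countᵇ p ys
countᵇ-++ p xs ys = trans (cong length (filter-++ (T? ∘ p) xs ys)) (length-++ (filterᵇ p xs))

countᵇ-map : ∀ {A B : Set} (p : B → Bool) (f : A → B) xs → countᵇ p (map f xs) ≡ countᵇ (p ∘ f) xs
countᵇ-map p f []       = refl
countᵇ-map p f (x ∷ xs) with p (f x)
... | true  = cong suc (countᵇ-map p f xs)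
... | false = countᵇ-map p f xs

countᵇ-concatMap : ∀ {A B : Set} (p : B → Bool) (f : A → List B) xs →
  countᵇ p (concatMap f xs) ≡ sum (map (countᵇ p ∘ f) xs)
countᵇ-concatMap p f []       = refl
countᵇ-concatMap p f (x ∷ xs) =
  trans (countᵇ-++ p (f x) (concatMap f xs)) (cong (countᵇ p (f x) +_) (countᵇ-concatMap p f xs))

countᵇ-byValue : ∀ {A : Set} {n} (p : A → Bool) (f : A → Fin n) xs →
  countᵇ p xs ≡ ∑[ v < n ] countᵇ (λ x → p x ∧ does (f x ≟ v)) xs
countᵇ-byValue {n = n} p f []       = sym (sum-replicate-zero n)
countᵇ-byValue {A} {n} p f (x ∷ xs) = begin
  countᵇ p (x ∷ xs)
    ≡⟨ countᵇ-∷ p x xs ⟩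
  ind (p x) + countᵇ p xs
    ≡⟨ cong₂ _+_ (sym (∑-indicator (p x) (f x))) (countᵇ-byValue p f xs) ⟩
  ∑[ v < n ] ind (q v x) + ∑[ v < n ] countᵇ (q v) xs
    ≡⟨ ∑-distrib-+ (λ v → ind (q v x)) (λ v → countᵇ (q v) xs) ⟨
  ∑[ v < n ] (ind (q v x) + countᵇ (q v) xs)
    ≡⟨ sum-cong-≗ (λ v → countᵇ-∷ (q v) x xs) ⟨
  ∑[ v < n ] countᵇ (q v) (x ∷ xs)
    ∎
  where
  open ≡-Reasoning
  q : Fin n → A → Bool
  q v y = p y ∧ does (f y ≟ v)

countTuples : ∀ n → ℕ → (List (Fin n) → Bool) → ℕ
countTuples n m r = countᵇ r (tuples n m)

countTuples-suc : ∀ n m (r : List (Fin n) → Bool) →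
  countTuples n (suc m) r ≡ ∑[ x < n ] countTuples n m (λ w → r (x ∷ w))
countTuples-suc n m r = begin
  countᵇ r (concatMap (λ x → map (x ∷_) (tuples n m)) (allFin n))
    ≡⟨ countᵇ-concatMap r _ (allFin n) ⟩
  sum (map (λ x → countᵇ r (map (x ∷_) (tuples n m))) (allFin n))
    ≡⟨ sum-map-tabulate (λ x → countᵇ r (map (x ∷_) (tuples n m))) id ⟩
  ∑[ x < n ] countᵇ r (map (x ∷_) (tuples n m))
    ≡⟨ sum-cong-≗ (λ x → countᵇ-map r (x ∷_) (tuples n m)) ⟩
  ∑[ x < n ] countTuples n m (λ w → r (x ∷ w))
    ∎
  where open ≡-Reasoning

countTuples-none : ∀ {n} m (r : List (Fin n) → Bool) →
  (∀ w → length w ≡ m → ¬ T (r w)) → countTuples n m r ≡ 0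
countTuples-none zero r none with r [] in eq
... | true  = ⊥-elim (none [] refl (≡true⇒T eq))
... | false = refl
countTuples-none {n} (suc m) r none =
  trans (countTuples-suc n m r) (∑-zero λ x → countTuples-none m _ λ w len → none (x ∷ w) (cong suc len))

countTuples-singleton : ∀ {n} m (r : List (Fin n) → Bool) w₀ → T (r w₀) → (∀ w → T (r w) → w ≡ w₀) →
  countTuples n m r ≡ ind (length w₀ ≡ᵇ m)
countTuples-singleton zero r [] rw₀ unique rewrite T⇒≡true rw₀ = refl
countTuples-singleton (suc m) r [] rw₀ unique =
  countTuples-none (suc m) r λ { [] () ; (x ∷ w) _ rw → case unique (x ∷ w) rw of λ () }
countTuples-singleton zero r (y ∷ w₀) rw₀ unique =
  countTuples-none zero r λ { [] _ rw → case unique [] rw of λ () }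
countTuples-singleton {n} (suc m) r (y ∷ w₀) rw₀ unique = begin
  countTuples n (suc m) r                       ≡⟨ countTuples-suc n m r ⟩
  ∑[ x < n ] countTuples n m (λ w → r (x ∷ w))  ≡⟨ ∑-single _ y off-y ⟩
  countTuples n m (λ w → r (y ∷ w))             ≡⟨ countTuples-singleton m _ w₀ rw₀ (λ w → ∷-injectiveʳ ∘ unique (y ∷ w)) ⟩
  ind (length w₀ ≡ᵇ m)                          ∎
  where
  open ≡-Reasoning
  off-y : ∀ x → x ≢ y → countTuples n m (λ w → r (x ∷ w)) ≡ 0
  off-y x x≢y = countTuples-none m _ λ w _ rw → x≢y (∷-injectiveˡ (unique (x ∷ w) rw))

module _ {n : ℕ} where

  elemᵇ-here : ∀ (x : Fin n) l → T (elemᵇ x (x ∷ l))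
  elemᵇ-here x l = Equivalence.from T-∨ (inj₁ (≡⇒≟ x x refl))

  elemᵇ-there : ∀ (x y : Fin n) l → T (elemᵇ x l) → T (elemᵇ x (y ∷ l))
  elemᵇ-there x y l x∈l = Equivalence.from T-∨ (inj₂ x∈l)

  elemᵇ-∷⁻ : ∀ (x y : Fin n) l → T (elemᵇ x (y ∷ l)) → x ≡ y ⊎ T (elemᵇ x l)
  elemᵇ-∷⁻ x y l x∈y∷l with x ≟ y
  ... | yes x≡y = inj₁ x≡y
  ... | no  _   = inj₂ x∈y∷l

  elemᵇ-++⁺ˡ : ∀ (x : Fin n) a b → T (elemᵇ x a) → T (elemᵇ x (a ++ b))
  elemᵇ-++⁺ˡ x (y ∷ a) b x∈y∷a with elemᵇ-∷⁻ x y a x∈y∷a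
  ... | inj₁ refl = elemᵇ-here x (a ++ b)
  ... | inj₂ x∈a  = elemᵇ-there x y (a ++ b) (elemᵇ-++⁺ˡ x a b x∈a)

  elemᵇ-∷ʳ⁻ : ∀ (x : Fin n) l v → T (elemᵇ x (l ++ v ∷ [])) → x ≡ v ⊎ T (elemᵇ x l)
  elemᵇ-∷ʳ⁻ x []      v x∈ with elemᵇ-∷⁻ x v [] x∈
  ... | inj₁ x≡v = inj₁ x≡v
  elemᵇ-∷ʳ⁻ x (y ∷ l) v x∈ with elemᵇ-∷⁻ x y (l ++ v ∷ []) x∈
  ... | inj₁ refl = inj₂ (elemᵇ-here x l)
  ... | inj₂ x∈′ with elemᵇ-∷ʳ⁻ x l v x∈′
  ...   | inj₁ x≡v = inj₁ x≡v
  ...   | inj₂ x∈l = inj₂ (elemᵇ-there x y l x∈l)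

  lastFrom-elemᵇ : ∀ (y : Fin n) w → T (elemᵇ (lastFrom y w) (y ∷ w))
  lastFrom-elemᵇ y []      = elemᵇ-here y []
  lastFrom-elemᵇ y (z ∷ w) = elemᵇ-there (lastFrom z w) y (z ∷ w) (lastFrom-elemᵇ z w)

  lastFrom-++ : ∀ (y : Fin n) w t → lastFrom y (w ++ t) ≡ lastFrom (lastFrom y w) t
  lastFrom-++ y []      t = refl
  lastFrom-++ y (z ∷ w) t = lastFrom-++ z w t

  lastFrom-∷ʳ : ∀ (y : Fin n) w v → lastFrom y (w ++ v ∷ []) ≡ v
  lastFrom-∷ʳ y w v = lastFrom-++ y w (v ∷ [])

  elemᵇ-∃++ : ∀ (v r : Fin n) l → T (elemᵇ v (r ∷ l)) →
    ∃ λ w → ∃ λ t → l ≡ w ++ t × lastFrom r w ≡ v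
  elemᵇ-∃++ v r l v∈ with elemᵇ-∷⁻ v r l v∈
  ... | inj₁ v≡r = [] , l , refl , sym v≡r
  elemᵇ-∃++ v r (y ∷ l) v∈ | inj₂ v∈l with elemᵇ-∃++ v y l v∈l
  ... | w , t , l≡w++t , last≡v = y ∷ w , t , cong (y ∷_) l≡w++t , last≡v

  distinct-tail : ∀ (x : Fin n) l → T (distinct (x ∷ l)) → T (distinct l)
  distinct-tail x l = ∧-snd

  distinct-head : ∀ (x : Fin n) l → T (distinct (x ∷ l)) → ¬ T (elemᵇ x l)
  distinct-head x l = T-not⁻ ∘ ∧-fst

  distinct-∷⁺ : ∀ (x : Fin n) l → ¬ T (elemᵇ x l) → T (distinct l) → T (distinct (x ∷ l))
  distinct-∷⁺ x l x∉l = ∧-intro (T-not⁺ x∉l)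

  distinct-no-backtrack : ∀ (x y : Fin n) l → ¬ T (distinct (x ∷ y ∷ x ∷ l))
  distinct-no-backtrack x y l d = distinct-head x (y ∷ x ∷ l) d (elemᵇ-there x y (x ∷ l) (elemᵇ-here x l))

  distinct-++⁻ˡ : ∀ (a b : List (Fin n)) → T (distinct (a ++ b)) → T (distinct a)
  distinct-++⁻ˡ []      b _ = tt
  distinct-++⁻ˡ (x ∷ a) b d = distinct-∷⁺ x a (distinct-head x (a ++ b) d ∘ elemᵇ-++⁺ˡ x a b)
                                (distinct-++⁻ˡ a b (distinct-tail x (a ++ b) d))

  distinct-∷ʳ : ∀ (l : List (Fin n)) v → T (distinct l) → ¬ T (elemᵇ v l) → T (distinct (l ++ v ∷ []))
  distinct-∷ʳ []      v _ _   = tt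
  distinct-∷ʳ (x ∷ l) v d v∉ = distinct-∷⁺ x (l ++ v ∷ []) x∉
    (distinct-∷ʳ l v (distinct-tail x l d) (v∉ ∘ elemᵇ-there v x l))
    where
    x∉ : ¬ T (elemᵇ x (l ++ v ∷ []))
    x∉ x∈ with elemᵇ-∷ʳ⁻ x l v x∈
    ... | inj₁ refl = v∉ (elemᵇ-here v l)
    ... | inj₂ x∈l  = distinct-head x l d x∈l

  distinct⇒length≤ : ∀ (l : List (Fin n)) → T (distinct l) → length l ≤ n
  distinct⇒length≤ l d = begin
    length l                                          ≡⟨ count-true l ⟨
    countᵇ (λ _ → true) l                             ≡⟨ countᵇ-byValue (λ _ → true) id l ⟩
    ∑[ v < n ] countᵇ (λ x → does (x ≟ v)) l          ≤⟨ ∑-mono-≤ (λ v → occurrences≤1 v l d) ⟩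
    ∑[ v < n ] 1                                      ≡⟨ ∑-one n ⟩
    n                                                 ∎
    where
    open ≤-Reasoning
    count-true : ∀ (l : List (Fin n)) → countᵇ (λ _ → true) l ≡ length l
    count-true []      = refl
    count-true (x ∷ l) = cong suc (count-true l)
    absent : ∀ v (l : List (Fin n)) → ¬ T (elemᵇ v l) → countᵇ (λ x → does (x ≟ v)) l ≡ 0
    absent v []      _  = refl
    absent v (x ∷ l) v∉ with x ≟ v
    ... | yes refl = ⊥-elim (v∉ (elemᵇ-here x l))
    ... | no  _    = absent v l (v∉ ∘ elemᵇ-there v x l)
    occurrences≤1 : ∀ v (l : List (Fin n)) → T (distinct l) → countᵇ (λ x → does (x ≟ v)) l ≤ 1
    occurrences≤1 v []      _ = z≤n
    occurrences≤1 v (x ∷ l) d with x ≟ v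
    ... | yes refl = s≤s (≤-reflexive (absent x l (distinct-head x l d)))
    ... | no  _    = occurrences≤1 v l (distinct-tail x l d)

module _ {n : ℕ} (G : Graph n) where

  isWalk-tail : ∀ x l → T (isWalk G (x ∷ l)) → T (isWalk G l)
  isWalk-tail x []      _ = tt
  isWalk-tail x (y ∷ l) w = ∧-snd {adj G x y} w

  isWalk-++⁻ˡ : ∀ (a b : List (Fin n)) → T (isWalk G (a ++ b)) → T (isWalk G a)
  isWalk-++⁻ˡ []          b _ = tt
  isWalk-++⁻ˡ (x ∷ [])    b _ = tt
  isWalk-++⁻ˡ (x ∷ y ∷ a) b w = ∧-intro (∧-fst w) (isWalk-++⁻ˡ (y ∷ a) b (∧-snd {adj G x y} w))

  isWalk-∷ʳ : ∀ r w v → T (isWalk G (r ∷ w)) → T (adj G (lastFrom r w) v) → T (isWalk G (r ∷ w ++ v ∷ []))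
  isWalk-∷ʳ r []      v _  e = ∧-intro e tt
  isWalk-∷ʳ r (y ∷ w) v rw e = ∧-intro (∧-fst rw) (isWalk-∷ʳ y w v (∧-snd {adj G r y} rw) e)

  isPath-tail : ∀ x l → T (isPath G (x ∷ l)) → T (isPath G l)
  isPath-tail x l p = ∧-intro (distinct-tail x l (∧-fst p)) (isWalk-tail x l (∧-snd {distinct (x ∷ l)} p))

  isPath-adj : ∀ x y l → T (isPath G (x ∷ y ∷ l)) → T (adj G x y)
  isPath-adj x y l p = ∧-fst (∧-snd {distinct (x ∷ y ∷ l)} p)

  isPath-∷⁺ : ∀ x y l → ¬ T (elemᵇ x (y ∷ l)) → T (adj G x y) → T (isPath G (y ∷ l)) →
    T (isPath G (x ∷ y ∷ l))
  isPath-∷⁺ x y l x∉ e p =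
    ∧-intro (distinct-∷⁺ x (y ∷ l) x∉ (∧-fst p)) (∧-intro e (∧-snd {distinct (y ∷ l)} p))

  isPath-++⁻ˡ : ∀ (a b : List (Fin n)) → T (isPath G (a ++ b)) → T (isPath G a)
  isPath-++⁻ˡ a b p = ∧-intro (distinct-++⁻ˡ a b (∧-fst p)) (isWalk-++⁻ˡ a b (∧-snd {distinct (a ++ b)} p))

  isPath-++⁻ʳ : ∀ y w t → T (isPath G (y ∷ w ++ t)) → T (isPath G (lastFrom y w ∷ t))
  isPath-++⁻ʳ y []      t p = p
  isPath-++⁻ʳ y (z ∷ w) t p = isPath-++⁻ʳ z w t (isPath-tail y (z ∷ w ++ t) p)

  isPath-∷ʳ : ∀ r w v → T (isPath G (r ∷ w)) → ¬ T (elemᵇ v (r ∷ w)) → T (adj G (lastFrom r w) v) →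
    T (isPath G (r ∷ w ++ v ∷ []))
  isPath-∷ʳ r w v p v∉ e =
    ∧-intro (distinct-∷ʳ (r ∷ w) v (∧-fst p) v∉) (isWalk-∷ʳ r w v (∧-snd {distinct (r ∷ w)} p) e)

  Walk : Fin n → Fin n → Set
  Walk u v = ∃ λ w → T (isWalk G (u ∷ w)) × lastFrom u w ≡ v

  walk-∷ : ∀ {u u′ v} → T (adj G u u′) → Walk u′ v → Walk u v
  walk-∷ {u′ = u′} e (w , u′w , last≡v) = u′ ∷ w , ∧-intro e u′w , last≡v

  -- shortcut every return to the start vertex
  walk⇒path : ∀ x w → T (isWalk G (x ∷ w)) →
    ∃ λ w′ → T (isPath G (x ∷ w′)) × lastFrom x w′ ≡ lastFrom x w
  walk⇒path x []      _  = [] , tt , refl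
  walk⇒path x (y ∷ w) xw with walk⇒path y w (∧-snd {adj G x y} xw)
  ... | w₁ , p₁ , last₁ with elemᵇ x (y ∷ w₁) in x∈?
  ...   | false = y ∷ w₁ , isPath-∷⁺ x y w₁ (λ x∈ → subst T x∈? x∈) (∧-fst xw) p₁ , last₁
  ...   | true with elemᵇ-∃++ x y w₁ (≡true⇒T x∈?)
  ...     | s , t , w₁≡s++t , lastₛ≡x = t , suffix , same-end
    where
    open ≡-Reasoning
    suffix : T (isPath G (x ∷ t))
    suffix = subst (λ z → T (isPath G (z ∷ t))) lastₛ≡x
               (isPath-++⁻ʳ y s t (subst (λ l → T (isPath G (y ∷ l))) w₁≡s++t p₁))
    same-end : lastFrom x t ≡ lastFrom y w
    same-end = begin
      lastFrom x t               ≡⟨ cong (λ z → lastFrom z t) lastₛ≡x ⟨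
      lastFrom (lastFrom y s) t  ≡⟨ lastFrom-++ y s t ⟨
      lastFrom y (s ++ t)        ≡⟨ cong (lastFrom y) w₁≡s++t ⟨
      lastFrom y w₁              ≡⟨ last₁ ⟩
      lastFrom y w               ∎

module _ {n : ℕ} {G : Graph n} (acyclic : Acyclic G) where

  -- If a lies on  b ∷ q, the two paths close a cycle through r; otherwise extend the second
  -- path back through r to a and move the fork one step along the first path.
  forked-paths-disjoint : ∀ r a b p q → T (isPath G (r ∷ a ∷ p)) → T (isPath G (r ∷ b ∷ q)) →
    a ≢ b → lastFrom a p ≢ lastFrom b q
  forked-paths-disjoint r a b p q rp rq a≢b same-end with elemᵇ a (b ∷ q) in a∈?
  ... | true with elemᵇ-∃++ a b q (≡true⇒T a∈?)
  ...   | []      , _ , _    , b≡a   = a≢b (sym b≡a)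
  ...   | z ∷ s   , t , q≡zs++t , last≡a = acyclic r (b ∷ z ∷ s) (s≤s (s≤s (s≤s z≤n))) cycle closing
    where
    cycle : T (isPath G (r ∷ b ∷ z ∷ s))
    cycle = isPath-++⁻ˡ G (r ∷ b ∷ z ∷ s) t (subst (λ l → T (isPath G (r ∷ b ∷ l))) q≡zs++t rq)
    closing : T (adj G (lastFrom z s) r)
    closing = subst (λ x → T (adj G x r)) (sym last≡a) (subst T (symm G r a) (isPath-adj G r a p rp))
  forked-paths-disjoint r a b [] q rp rq a≢b same-end | false =
    subst T a∈? (subst (λ x → T (elemᵇ x (b ∷ q))) (sym same-end) (lastFrom-elemᵇ b q))
  forked-paths-disjoint r a b (a₂ ∷ p) q rp rq a≢b same-end | false =
    forked-paths-disjoint a a₂ r p (b ∷ q) (isPath-tail G r (a ∷ a₂ ∷ p) rp) aq a₂≢r same-end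
    where
    a∉ : ¬ T (elemᵇ a (r ∷ b ∷ q))
    a∉ a∈ with elemᵇ-∷⁻ a r (b ∷ q) a∈
    ... | inj₁ refl = distinct-head a (a ∷ a₂ ∷ p) (∧-fst rp) (elemᵇ-here a (a₂ ∷ p))
    ... | inj₂ a∈′  = subst T a∈? a∈′
    aq : T (isPath G (a ∷ r ∷ b ∷ q))
    aq = isPath-∷⁺ G a r (b ∷ q) a∉ (subst T (symm G r a) (isPath-adj G r a (a₂ ∷ p) rp)) rq
    a₂≢r : a₂ ≢ r
    a₂≢r refl = distinct-no-backtrack r a p (∧-fst rp)

  path-unique : ∀ r w w′ → T (isPath G (r ∷ w)) → T (isPath G (r ∷ w′)) →
    lastFrom r w ≡ lastFrom r w′ → w ≡ w′
  path-unique r []      []       _  _  _        = refl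
  path-unique r []      (b ∷ q)  _  rq same-end =
    ⊥-elim (distinct-head r (b ∷ q) (∧-fst rq)
              (subst (λ x → T (elemᵇ x (b ∷ q))) (sym same-end) (lastFrom-elemᵇ b q)))
  path-unique r (a ∷ p) []       rp _  same-end =
    ⊥-elim (distinct-head r (a ∷ p) (∧-fst rp)
              (subst (λ x → T (elemᵇ x (a ∷ p))) same-end (lastFrom-elemᵇ a p)))
  path-unique r (a ∷ p) (b ∷ q)  rp rq same-end with a ≟ b
  ... | yes refl = cong (a ∷_) (path-unique a p q (isPath-tail G r (a ∷ p) rp) (isPath-tail G r (a ∷ q) rq) same-end)
  ... | no  a≢b  = ⊥-elim (forked-paths-disjoint r a b p q rp rq a≢b same-end)

-- Counting paths by their ends

evenAtLeast2 : ℕ → Bool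
evenAtLeast2 k = (k % 2 ≡ᵇ 0) ∧ (2 ≤ᵇ k)

module _ {n : ℕ} (G : Graph n) where

  canonicalPathTo : Fin n → Fin n → List (Fin n) → Bool
  canonicalPathTo u v w = (isPath G (u ∷ w) ∧ canonical (u ∷ w)) ∧ does (lastFrom u w ≟ v)

  canonicalPaths : ℕ → Fin n → Fin n → ℕ
  canonicalPaths k u v = countTuples n k (canonicalPathTo u v)

  canonicalPathTo-end : ∀ u v w → T (canonicalPathTo u v w) → lastFrom u w ≡ v
  canonicalPathTo-end u v w = ≟⇒≡ (lastFrom u w) v ∘ ∧-snd {isPath G (u ∷ w) ∧ canonical (u ∷ w)}

  canonicalPaths-≮ : ∀ k u v → (toℕ u <ᵇ toℕ v) ≡ false → canonicalPaths k u v ≡ 0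
  canonicalPaths-≮ k u v u≮v = countTuples-none k _ λ w _ rw →
    subst T (trans (cong (λ x → toℕ u <ᵇ toℕ x) (canonicalPathTo-end u v w rw)) u≮v)
            (∧-snd {isPath G (u ∷ w)} (∧-fst rw))

  evenCanonicalPaths : Fin n → Fin n → ℕ
  evenCanonicalPaths u v = ∑[ k < n ] (if evenAtLeast2 (toℕ k) then canonicalPaths (toℕ k) u v else 0)

  numPaths-byEnds : ∀ k → numPaths G k ≡ ∑[ u < n ] ∑[ v < n ] canonicalPaths k u v
  numPaths-byEnds k = trans (countTuples-suc n k _) (sum-cong-≗ λ u → countᵇ-byValue _ (lastFrom u) (tuples n k))

  X-byEnds : X G ≡ ∑[ u < n ] ∑[ v < n ] evenCanonicalPaths u v
  X-byEnds = begin
    X G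
      ≡⟨ sum-applyUpTo _ id n ⟩
    ∑[ k < n ] (if e k then numPaths G (toℕ k) else 0)
      ≡⟨ sum-cong-≗ (λ k → cong (λ z → if e k then z else 0) (numPaths-byEnds (toℕ k))) ⟩
    ∑[ k < n ] (if e k then ∑[ u < n ] ∑[ v < n ] cp k u v else 0)
      ≡⟨ sum-cong-≗ (λ k → trans (∑-if (e k) (λ u → ∑[ v < n ] cp k u v)) (sum-cong-≗ λ u → ∑-if (e k) (cp k u))) ⟩
    ∑[ k < n ] ∑[ u < n ] ∑[ v < n ] (if e k then cp k u v else 0)
      ≡⟨ ∑-comm (λ k u → ∑[ v < n ] (if e k then cp k u v else 0)) ⟩
    ∑[ u < n ] ∑[ k < n ] ∑[ v < n ] (if e k then cp k u v else 0)
      ≡⟨ sum-cong-≗ (λ u → ∑-comm (λ k v → if e k then cp k u v else 0)) ⟩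
    ∑[ u < n ] ∑[ v < n ] evenCanonicalPaths u v
      ∎
    where
    open ≡-Reasoning
    e : Fin n → Bool
    e k = evenAtLeast2 (toℕ k)
    cp : Fin n → Fin n → Fin n → ℕ
    cp k = canonicalPaths (toℕ k)

-- Proper 2-colourings and parity of walks

evenᵇ : ℕ → Bool
evenᵇ zero    = true
evenᵇ (suc k) = not (evenᵇ k)

evenᵇ-% : ∀ k → (k % 2 ≡ᵇ 0) ≡ evenᵇ k
evenᵇ-% zero          = refl
evenᵇ-% (suc zero)    = refl
evenᵇ-% (suc (suc k)) = trans (evenᵇ-% k) (sym (not-involutive (evenᵇ k)))

evenAtLeast2-evenᵇ : ∀ k → 1 ≤ k → evenAtLeast2 k ≡ evenᵇ k
evenAtLeast2-evenᵇ (suc zero)    _ = refl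
evenAtLeast2-evenᵇ (suc (suc k)) _ = trans (∧-identityʳ _) (evenᵇ-% (suc (suc k)))

_==_ : Bool → Bool → Bool
true  == b = b
false == b = not b

==-refl : ∀ a → (a == a) ≡ true
==-refl true  = refl
==-refl false = refl

not-== : ∀ a b → (not a == b) ≡ not (a == b)
not-== true  b = refl
not-== false b = sym (not-involutive b)

Proper : ∀ {n} → Graph n → (Fin n → Bool) → Set
Proper G c = ∀ u v → T (adj G u v) → c v ≡ not (c u)

walk-parity : ∀ {n} {G : Graph n} {c : Fin n → Bool} → Proper G c →
  ∀ x w → T (isWalk G (x ∷ w)) → (c x == c (lastFrom x w)) ≡ evenᵇ (length w)
walk-parity {c = c} proper x []      _  = ==-refl (c x)
walk-parity {G = G} {c} proper x (y ∷ w) xw = begin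
  c x == c (lastFrom y w)        ≡⟨ cong (_== c (lastFrom y w)) cx≡not-cy ⟩
  not (c y) == c (lastFrom y w)  ≡⟨ not-== (c y) _ ⟩
  not (c y == c (lastFrom y w))  ≡⟨ cong not (walk-parity proper y w (∧-snd {adj G x y} xw)) ⟩
  not (evenᵇ (length w))         ∎
  where
  open ≡-Reasoning
  cx≡not-cy : c x ≡ not (c y)
  cx≡not-cy = trans (sym (not-involutive (c x))) (cong not (sym (proper x y (∧-fst xw))))

monochromatic : ∀ {n} → (Fin n → Bool) → Fin n → Fin n → Bool
monochromatic c u v = (toℕ u <ᵇ toℕ v) ∧ (c u == c v)

monochromaticPairs : ∀ n → (Fin n → Bool) → ℕ
monochromaticPairs n c = ∑[ u < n ] ∑[ v < n ] ind (monochromatic c u v)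

-- Trees

module _ {n : ℕ} (τ : Tree n) where

  private
    G : Graph n
    G = graph τ

  treePath-spec : ∀ u v → ∃ λ w → T (isPath G (u ∷ w)) × lastFrom u w ≡ v
  treePath-spec u v with connected τ u v
  ... | w , uw , last≡v with walk⇒path G u w uw
  ...   | w′ , p , last≡ = w′ , p , trans last≡ last≡v

  treePath : Fin n → Fin n → List (Fin n)
  treePath u v = proj₁ (treePath-spec u v)

  treePath-isPath : ∀ u v → T (isPath G (u ∷ treePath u v))
  treePath-isPath u v = proj₁ (proj₂ (treePath-spec u v))

  treePath-last : ∀ u v → lastFrom u (treePath u v) ≡ v
  treePath-last u v = proj₂ (proj₂ (treePath-spec u v))

  treePath-unique : ∀ u v w → T (isPath G (u ∷ w)) → lastFrom u w ≡ v → w ≡ treePath u v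
  treePath-unique u v w p last≡v =
    path-unique (acyclic τ) u w (treePath u v) p (treePath-isPath u v) (trans last≡v (sym (treePath-last u v)))

  canonicalPaths-tree : ∀ k u v → T (toℕ u <ᵇ toℕ v) →
    canonicalPaths G k u v ≡ ind (length (treePath u v) ≡ᵇ k)
  canonicalPaths-tree k u v u<v = countTuples-singleton k _ (treePath u v) witness λ w rw →
    treePath-unique u v w (∧-fst (∧-fst rw)) (canonicalPathTo-end G u v w rw)
    where
    witness : T (canonicalPathTo G u v (treePath u v))
    witness = ∧-intro (∧-intro (treePath-isPath u v) (subst (λ x → T (toℕ u <ᵇ toℕ x)) (sym (treePath-last u v)) u<v))
                      (≡⇒≟ (lastFrom u (treePath u v)) v (treePath-last u v))

  treePath-length< : ∀ u v → length (treePath u v) < n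
  treePath-length< u v = distinct⇒length≤ (u ∷ treePath u v) (∧-fst (treePath-isPath u v))

  treePath-nonempty : ∀ u v → u ≢ v → 1 ≤ length (treePath u v)
  treePath-nonempty u v u≢v with treePath u v | treePath-last u v
  ... | []    | u≡v = ⊥-elim (u≢v u≡v)
  ... | _ ∷ _ | _   = s≤s z≤n

  treePath-parity : ∀ {c} → Proper G c → ∀ u v → (c u == c v) ≡ evenᵇ (length (treePath u v))
  treePath-parity {c} proper u v =
    trans (cong (λ x → c u == c x) (sym (treePath-last u v)))
          (walk-parity proper u (treePath u v) (∧-snd {distinct (u ∷ treePath u v)} (treePath-isPath u v)))

  -- The only candidate is the tree path from u to v; its length is even iff c u = c v.
  evenCanonicalPaths-tree : ∀ {c} → Proper G c → ∀ u v → evenCanonicalPaths G u v ≡ ind (monochromatic c u v)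
  evenCanonicalPaths-tree {c} proper u v with toℕ u <ᵇ toℕ v in u<v
  ... | false = ∑-zero {n} λ k →
    trans (cong (λ z → if evenAtLeast2 (toℕ k) then z else 0) (canonicalPaths-≮ G (toℕ k) u v u<v)) (if-same _ 0)
  ... | true  = begin
    ∑[ k < n ] (if e k then canonicalPaths G (toℕ k) u v else 0)
      ≡⟨ sum-cong-≗ (λ k → cong (λ z → if e k then z else 0) (canonicalPaths-tree (toℕ k) u v (≡true⇒T u<v))) ⟩
    ∑[ k < n ] (if e k then ind (length (treePath u v) ≡ᵇ toℕ k) else 0)
      ≡⟨ ∑-≡ᵇ evenAtLeast2 (treePath-length< u v) ⟩
    ind (evenAtLeast2 (length (treePath u v)))
      ≡⟨ cong ind (evenAtLeast2-evenᵇ _ (treePath-nonempty u v u≢v)) ⟩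
    ind (evenᵇ (length (treePath u v)))
      ≡⟨ cong ind (treePath-parity proper u v) ⟨
    ind (c u == c v)
      ∎
    where
    open ≡-Reasoning
    e : Fin n → Bool
    e k = evenAtLeast2 (toℕ k)
    u≢v : u ≢ v
    u≢v u≡v = <-irrefl (cong toℕ u≡v) (<ᵇ⇒< (toℕ u) (toℕ v) (≡true⇒T u<v))

  X-tree : ∀ {c} → Proper G c → X G ≡ monochromaticPairs n c
  X-tree proper = trans (X-byEnds G) (sum-cong-≗ λ u → sum-cong-≗ λ v → evenCanonicalPaths-tree proper u v)

  depth : Fin n → Fin n → ℕ
  depth r v = length (treePath r v)

  depth-extend : ∀ r u v → T (adj G u v) → ¬ T (elemᵇ v (r ∷ treePath r u)) → depth r v ≡ suc (depth r u)
  depth-extend r u v uv v∉ = begin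
    depth r v                        ≡⟨ cong length (treePath-unique r v (treePath r u ++ v ∷ []) extended (lastFrom-∷ʳ r (treePath r u) v)) ⟨
    length (treePath r u ++ v ∷ [])  ≡⟨ length-++ (treePath r u) ⟩
    depth r u + 1                    ≡⟨ +-comm (depth r u) 1 ⟩
    suc (depth r u)                  ∎
    where
    open ≡-Reasoning
    extended : T (isPath G (r ∷ treePath r u ++ v ∷ []))
    extended = isPath-∷ʳ G r (treePath r u) v (treePath-isPath r u) v∉ (subst (λ x → T (adj G x v)) (sym (treePath-last r u)) uv)

  depth-on-path : ∀ r u v → u ≢ v → T (elemᵇ v (r ∷ treePath r u)) → depth r v < depth r u
  depth-on-path r u v u≢v v∈ with elemᵇ-∃++ v r (treePath r u) v∈
  ... | s , [] , path≡s , lastₛ≡v = ⊥-elim (u≢v (begin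
    u                              ≡⟨ treePath-last r u ⟨
    lastFrom r (treePath r u)      ≡⟨ cong (lastFrom r) path≡s ⟩
    lastFrom r (s ++ [])           ≡⟨ lastFrom-++ r s [] ⟩
    lastFrom r s                   ≡⟨ lastₛ≡v ⟩
    v                              ∎))
    where open ≡-Reasoning
  ... | s , z ∷ t , path≡s++zt , lastₛ≡v = begin-strict
    depth r v                  ≡⟨ cong length (treePath-unique r v s prefix lastₛ≡v) ⟨
    length s                   <⟨ m<m+n (length s) z<s ⟩
    length s + length (z ∷ t)  ≡⟨ length-++ s ⟨
    length (s ++ z ∷ t)        ≡⟨ cong length path≡s++zt ⟨
    depth r u                  ∎
    where
    open ≤-Reasoning
    prefix : T (isPath G (r ∷ s))
    prefix = isPath-++⁻ˡ G (r ∷ s) (z ∷ t) (subst (λ l → T (isPath G (r ∷ l))) path≡s++zt (treePath-isPath r u))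

  depth-adjacent : ∀ r u v → T (adj G u v) → depth r v ≡ suc (depth r u) ⊎ depth r u ≡ suc (depth r v)
  depth-adjacent r u v uv with elemᵇ v (r ∷ treePath r u) in v∈? | elemᵇ u (r ∷ treePath r v) in u∈?
  ... | false | _     = inj₁ (depth-extend r u v uv (subst T v∈?))
  ... | true  | false = inj₂ (depth-extend r v u (subst T (symm G u v) uv) (subst T u∈?))
  ... | true  | true  = ⊥-elim (<-asym (depth-on-path r u v u≢v (≡true⇒T v∈?)) (depth-on-path r v u (u≢v ∘ sym) (≡true⇒T u∈?)))
    where
    u≢v : u ≢ v
    u≢v refl = subst T (irrefl G u) uv

  depthParity-proper : ∀ r → Proper G (λ v → evenᵇ (depth r v))
  depthParity-proper r u v uv with depth-adjacent r u v uv
  ... | inj₁ dv≡1+du = cong evenᵇ dv≡1+du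
  ... | inj₂ du≡1+dv = sym (trans (cong (not ∘ evenᵇ) du≡1+dv) (not-involutive _))

tree-2-colourable : ∀ {n} (τ : Tree n) → ∃ (Proper (graph τ))
tree-2-colourable {zero}  τ = (λ ()) , λ ()
tree-2-colourable {suc n} τ = (λ v → evenᵇ (depth τ fz v)) , depthParity-proper τ fz

-- Counting monochromatic pairs

colourClass : ∀ n → (Fin n → Bool) → ℕ
colourClass n c = ∑[ u < n ] ind (c u)

colourClasses-sum : ∀ n (c : Fin n → Bool) → colourClass n c + colourClass n (not ∘ c) ≡ n
colourClasses-sum zero    c = refl
colourClasses-sum (suc n) c with c fz
... | true  = cong suc (colourClasses-sum n (c ∘ fs))
... | false = trans (+-suc _ _) (cong suc (colourClasses-sum n (c ∘ fs)))

add-to-class : ∀ x y s n → 2 * s + n ≡ x * x + y * y → 2 * (x + s) + suc n ≡ suc x * suc x + y * y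
add-to-class x y s n ih = begin
  2 * (x + s) + suc n          ≡⟨ solve 3 (λ x s n → con 2 :* (x :+ s) :+ (con 1 :+ n) := con 2 :* x :+ con 1 :+ (con 2 :* s :+ n)) refl x s n ⟩
  2 * x + 1 + (2 * s + n)      ≡⟨ cong (2 * x + 1 +_) ih ⟩
  2 * x + 1 + (x * x + y * y)  ≡⟨ solve 2 (λ x y → con 2 :* x :+ con 1 :+ (x :* x :+ y :* y) := (con 1 :+ x) :* (con 1 :+ x) :+ y :* y) refl x y ⟩
  suc x * suc x + y * y        ∎
  where open ≡-Reasoning

monochromaticPairs-squares : ∀ n (c : Fin n → Bool) → let a = colourClass n c; b = colourClass n (not ∘ c) in
  2 * monochromaticPairs n c + n ≡ a * a + b * b
monochromaticPairs-squares zero    c = refl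
monochromaticPairs-squares (suc n) c with c fz | monochromaticPairs-squares n (c ∘ fs)
... | true  | ih = add-to-class a b s n ih
  where
  a b s : ℕ
  a = colourClass n (c ∘ fs)
  b = colourClass n (not ∘ c ∘ fs)
  s = monochromaticPairs n (c ∘ fs)
... | false | ih = trans (add-to-class b a s n (trans ih (+-comm (a * a) (b * b)))) (+-comm _ (a * a))
  where
  a b s : ℕ
  a = colourClass n (c ∘ fs)
  b = colourClass n (not ∘ c ∘ fs)
  s = monochromaticPairs n (c ∘ fs)

-- 2 (a² + b²) = (a + b)² + (a − b)²,  with  a = b + d
twice-sum-of-squares : ∀ b d → 2 * ((b + d) * (b + d) + b * b) ≡ (b + d + b) * (b + d + b) + d * d
twice-sum-of-squares = solve 2 (λ b d → con 2 :* ((b :+ d) :* (b :+ d) :+ b :* b) := (b :+ d :+ b) :* (b :+ d :+ b) :+ d :* d) refl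

square-of-sum≤ : ∀ a b → (a + b) * (a + b) ≤ 2 * (a * a + b * b)
square-of-sum≤ a b with ≤-total b a
... | inj₁ b≤a with m≤n⇒∃[o]m+o≡n b≤a
...   | d , refl = subst ((b + d + b) * (b + d + b) ≤_) (sym (twice-sum-of-squares b d)) (m≤m+n _ _)
square-of-sum≤ a b | inj₂ a≤b with m≤n⇒∃[o]m+o≡n a≤b
...   | d , refl = subst₂ _≤_ (cong (λ x → x * x) (+-comm (a + d) a)) (sym (trans (cong (2 *_) (+-comm (a * a) _)) (twice-sum-of-squares a d)))
                     (m≤m+n _ _)

square-of-sum≥ : ∀ b d → d ≤ 1 → 2 * ((b + d) * (b + d) + b * b) ≤ (b + d + b) * (b + d + b) + 1
square-of-sum≥ b d d≤1 = subst (_≤ (b + d + b) * (b + d + b) + 1) (sym (twice-sum-of-squares b d)) (+-monoʳ-≤ _ (*-mono-≤ d≤1 d≤1))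

ceil4-≤ : ∀ {m s} → m ≤ 4 * s → ceil4 m ≤ s
ceil4-≤ {m} {s} m≤4s = m<1+n⇒m≤n (m<n*o⇒m/o<n (begin-strict
  m + 3      <⟨ +-monoʳ-< m (n<1+n 3) ⟩
  m + 4      ≤⟨ +-monoˡ-≤ 4 m≤4s ⟩
  4 * s + 4  ≡⟨ solve 1 (λ s → con 4 :* s :+ con 4 := (con 1 :+ s) :* con 4) refl s ⟩
  suc s * 4  ∎))
  where open ≤-Reasoning

≤-ceil4 : ∀ {m s} → 4 * s ≤ m + 3 → s ≤ ceil4 m
≤-ceil4 {m} {s} 4s≤m+3 = subst (_≤ ceil4 m) (m*n/n≡m s 4) (/-monoˡ-≤ 4 (subst (_≤ m + 3) (*-comm 4 s) 4s≤m+3))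

≥-n[n∸2] : ∀ n x → n * n ≤ x + 2 * n → n * (n ∸ 2) ≤ x
≥-n[n∸2] zero          x _  = z≤n
≥-n[n∸2] (suc zero)    x _  = z≤n
≥-n[n∸2] (suc (suc m)) x le = +-cancelʳ-≤ (2 * N) (N * m) x (subst (_≤ x + 2 * N) (sym N*m+2N≡N*N) le)
  where
  N : ℕ
  N = suc (suc m)
  N*m+2N≡N*N : N * m + 2 * N ≡ N * N
  N*m+2N≡N*N = solve 1 (λ m → (con 2 :+ m) :* m :+ con 2 :* (con 2 :+ m) := (con 2 :+ m) :* (con 2 :+ m)) refl m

≤-n[n∸2]+3 : ∀ n x → x + 2 * n ≤ n * n + 1 → x ≤ n * (n ∸ 2) + 3
≤-n[n∸2]+3 zero          x le = ≤-trans (≤-trans (m≤m+n x 0) le) (s≤s z≤n)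
≤-n[n∸2]+3 (suc zero)    x le = ≤-trans (+-cancelʳ-≤ 2 x 0 le) z≤n
≤-n[n∸2]+3 (suc (suc m)) x le = ≤-trans (+-cancelʳ-≤ (2 * N) x (N * m + 1) (subst (x + 2 * N ≤_) N*N+1≡ le)) (+-monoʳ-≤ (N * m) (s≤s z≤n))
  where
  N : ℕ
  N = suc (suc m)
  N*N+1≡ : N * N + 1 ≡ N * m + 1 + 2 * N
  N*N+1≡ = solve 1 (λ m → (con 2 :+ m) :* (con 2 :+ m) :+ con 1 := (con 2 :+ m) :* m :+ con 1 :+ con 2 :* (con 2 :+ m)) refl m

4s+2n≡2[a²+b²] : ∀ n (c : Fin n → Bool) → let a = colourClass n c; b = colourClass n (not ∘ c) in
  4 * monochromaticPairs n c + 2 * n ≡ 2 * (a * a + b * b)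
4s+2n≡2[a²+b²] n c = trans (solve 2 (λ s n → con 4 :* s :+ con 2 :* n := con 2 :* (con 2 :* s :+ n)) refl (monochromaticPairs n c) n)
                           (cong (2 *_) (monochromaticPairs-squares n c))

monochromaticPairs-≥ : ∀ n (c : Fin n → Bool) → ceil4 (n * (n ∸ 2)) ≤ monochromaticPairs n c
monochromaticPairs-≥ n c = ceil4-≤ (≥-n[n∸2] n _ (begin
  n * n                ≡⟨ cong (λ x → x * x) (colourClasses-sum n c) ⟨
  (a + b) * (a + b)    ≤⟨ square-of-sum≤ a b ⟩
  2 * (a * a + b * b)  ≡⟨ 4s+2n≡2[a²+b²] n c ⟨
  4 * monochromaticPairs n c + 2 * n  ∎))
  where
  open ≤-Reasoning
  a b : ℕ
  a = colourClass n c
  b = colourClass n (not ∘ c)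

monochromaticPairs-balanced : ∀ n (c : Fin n → Bool) d → colourClass n c ≡ colourClass n (not ∘ c) + ind d →
  monochromaticPairs n c ≡ ceil4 (n * (n ∸ 2))
monochromaticPairs-balanced n c d a≡b+d = ≤-antisym (≤-ceil4 (≤-n[n∸2]+3 n _ (begin
  4 * monochromaticPairs n c + 2 * n                  ≡⟨ 4s+2n≡2[a²+b²] n c ⟩
  2 * (a * a + b * b)                                 ≡⟨ cong (λ x → 2 * (x * x + b * b)) a≡b+d ⟩
  2 * ((b + ind d) * (b + ind d) + b * b)             ≤⟨ square-of-sum≥ b (ind d) (ind≤1 d) ⟩
  (b + ind d + b) * (b + ind d + b) + 1               ≡⟨ cong (λ x → x * x + 1) (trans (cong (_+ b) (sym a≡b+d)) (colourClasses-sum n c)) ⟩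
  n * n + 1                                           ∎)))
  (monochromaticPairs-≥ n c)
  where
  open ≤-Reasoning
  a b : ℕ
  a = colourClass n c
  b = colourClass n (not ∘ c)
  ind≤1 : ∀ d → ind d ≤ 1
  ind≤1 true  = s≤s z≤n
  ind≤1 false = z≤n

-- The path Pₙ

parity : ∀ {n} → Fin n → Bool
parity i = evenᵇ (toℕ i)

not-not-parity : ∀ n → colourClass n (not ∘ not ∘ parity) ≡ colourClass n parity
not-not-parity n = sum-cong-≗ {n} (λ i → cong ind (not-involutive (parity i)))

parity-classes : ∀ n → colourClass n parity ≡ colourClass n (not ∘ parity) + ind (not (evenᵇ n))
parity-classes zero    = refl
parity-classes (suc n) with evenᵇ n | parity-classes n
... | true  | ih = begin
  suc (colourClass n (not ∘ parity))  ≡⟨ cong suc (sym (trans ih (+-identityʳ _))) ⟩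
  suc (colourClass n parity)          ≡⟨ +-comm 1 _ ⟩
  colourClass n parity + 1            ≡⟨ cong (_+ 1) (not-not-parity n) ⟨
  colourClass n (not ∘ not ∘ parity) + 1 ∎
  where open ≡-Reasoning
... | false | ih = begin
  suc (colourClass n (not ∘ parity))  ≡⟨ trans (+-comm 1 _) (sym ih) ⟩
  colourClass n parity                ≡⟨ not-not-parity n ⟨
  colourClass n (not ∘ not ∘ parity)  ≡⟨ +-identityʳ _ ⟨
  colourClass n (not ∘ not ∘ parity) + 0 ∎
  where open ≡-Reasoning

module _ (n : ℕ) where

  P-adj⁻ : ∀ (i j : Fin n) → T (adj (P n) i j) → toℕ j ≡ suc (toℕ i) ⊎ toℕ i ≡ suc (toℕ j)
  P-adj⁻ i j ij with Equivalence.to T-∨ ij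
  ... | inj₁ e = inj₁ (sym (≡ᵇ⇒≡ _ _ e))
  ... | inj₂ e = inj₂ (sym (≡ᵇ⇒≡ _ _ e))

  parity-proper : Proper (P n) parity
  parity-proper i j ij with P-adj⁻ i j ij
  ... | inj₁ j≡1+i = cong evenᵇ j≡1+i
  ... | inj₂ i≡1+j = sym (trans (cong (not ∘ evenᵇ) i≡1+j) (not-involutive _))

  Ascending Descending : Fin n → List (Fin n) → Set
  Ascending  x []      = ⊤
  Ascending  x (y ∷ w) = toℕ y ≡ suc (toℕ x) × Ascending y w
  Descending x []      = ⊤
  Descending x (y ∷ w) = toℕ x ≡ suc (toℕ y) × Descending y w

  -- turning back would revisit x
  ascending-continues : ∀ x y w → T (distinct (x ∷ y ∷ w)) → T (isWalk (P n) (y ∷ w)) →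
    toℕ y ≡ suc (toℕ x) → Ascending y w
  ascending-continues x y []      _ _  _ = tt
  ascending-continues x y (z ∷ w) d yw y≡1+x with P-adj⁻ y z (∧-fst yw)
  ... | inj₁ z≡1+y = z≡1+y , ascending-continues y z w (distinct-tail x (y ∷ z ∷ w) d) (∧-snd {adj (P n) y z} yw) z≡1+y
  ... | inj₂ y≡1+z with toℕ-injective {i = z} {j = x} (suc-injective (trans (sym y≡1+z) y≡1+x))
  ...   | refl = ⊥-elim (distinct-no-backtrack x y w d)

  descending-continues : ∀ x y w → T (distinct (x ∷ y ∷ w)) → T (isWalk (P n) (y ∷ w)) →
    toℕ x ≡ suc (toℕ y) → Descending y w
  descending-continues x y []      _ _  _ = tt
  descending-continues x y (z ∷ w) d yw x≡1+y with P-adj⁻ y z (∧-fst yw)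
  ... | inj₂ y≡1+z = y≡1+z , descending-continues y z w (distinct-tail x (y ∷ z ∷ w) d) (∧-snd {adj (P n) y z} yw) y≡1+z
  ... | inj₁ z≡1+y with toℕ-injective {i = z} {j = x} (trans z≡1+y (sym x≡1+y))
  ...   | refl = ⊥-elim (distinct-no-backtrack x y w d)

  m+2+n≢1+m : ∀ m {n} → 2 ≤ n → m + n ≢ suc m
  m+2+n≢1+m m {suc zero}    (s≤s ())
  m+2+n≢1+m m {suc (suc n)} _ m+2+n≡1+m = m+1+n≢m m (suc-injective (trans (sym (+-suc m (suc n))) m+2+n≡1+m))

  path-monotone : ∀ x w → T (isPath (P n) (x ∷ w)) → Ascending x w ⊎ Descending x w
  path-monotone x []      _ = inj₁ tt
  path-monotone x (y ∷ w) p with P-adj⁻ x y (isPath-adj (P n) x y w p)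
  ... | inj₁ y≡1+x = inj₁ (y≡1+x , ascending-continues x y w (∧-fst p) (isWalk-tail (P n) x (y ∷ w) (∧-snd {distinct (x ∷ y ∷ w)} p)) y≡1+x)
  ... | inj₂ x≡1+y = inj₂ (x≡1+y , descending-continues x y w (∧-fst p) (isWalk-tail (P n) x (y ∷ w) (∧-snd {distinct (x ∷ y ∷ w)} p)) x≡1+y)

  ascending-last : ∀ x w → Ascending x w → toℕ (lastFrom x w) ≡ toℕ x + length w
  ascending-last x []      _             = sym (+-identityʳ _)
  ascending-last x (y ∷ w) (y≡1+x , asc) = trans (ascending-last y w asc) (trans (cong (_+ length w) y≡1+x) (sym (+-suc _ _)))

  descending-last : ∀ x w → Descending x w → toℕ x ≡ toℕ (lastFrom x w) + length w
  descending-last x []      _              = sym (+-identityʳ _)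
  descending-last x (y ∷ w) (x≡1+y , desc) = trans x≡1+y (trans (cong suc (descending-last y w desc)) (sym (+-suc _ _)))

  P-acyclic : Acyclic (P n)
  P-acyclic u w 3≤ p last~u with path-monotone u w p | P-adj⁻ (lastFrom u w) u last~u
  ... | inj₁ asc  | inj₁ u≡1+last = m≢1+m+n (toℕ u) (trans u≡1+last (cong suc (ascending-last u w asc)))
  ... | inj₁ asc  | inj₂ last≡1+u = m+2+n≢1+m (toℕ u) (≤-pred 3≤) (trans (sym (ascending-last u w asc)) last≡1+u)
  ... | inj₂ desc | inj₁ u≡1+last = m+2+n≢1+m (toℕ (lastFrom u w)) (≤-pred 3≤) (trans (sym (descending-last u w desc)) u≡1+last)
  ... | inj₂ desc | inj₂ last≡1+u = m≢1+m+n (toℕ (lastFrom u w)) (trans last≡1+u (cong suc (descending-last u w desc)))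

  ascend : ∀ d (u v : Fin n) → toℕ u + d ≡ toℕ v → Walk (P n) u v
  ascend zero    u v u+0≡v = [] , tt , toℕ-injective (trans (sym (+-identityʳ _)) u+0≡v)
  ascend (suc d) u v u+1+d≡v = walk-∷ (P n) (Equivalence.from T-∨ (inj₁ (≡⇒≡ᵇ _ _ (sym (toℕ-fromℕ< 1+u<n)))))
    (ascend d (fromℕ< 1+u<n) v (trans (cong (_+ d) (toℕ-fromℕ< 1+u<n)) (trans (sym (+-suc _ _)) u+1+d≡v)))
    where
    1+u<n : suc (toℕ u) < n
    1+u<n = begin-strict
      suc (toℕ u)      ≤⟨ s≤s (m≤m+n (toℕ u) d) ⟩
      suc (toℕ u + d)  ≡⟨ +-suc (toℕ u) d ⟨
      toℕ u + suc d    ≡⟨ u+1+d≡v ⟩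
      toℕ v            <⟨ toℕ<n v ⟩
      n                ∎
      where open ≤-Reasoning

  descend : ∀ d (u v : Fin n) → toℕ v + d ≡ toℕ u → Walk (P n) u v
  descend zero    u v v+0≡u = [] , tt , toℕ-injective (sym (trans (sym (+-identityʳ _)) v+0≡u))
  descend (suc d) u v v+1+d≡u = walk-∷ (P n) (Equivalence.from T-∨ (inj₂ (≡⇒≡ᵇ _ _ (sym u≡1+u′))))
    (descend d (fromℕ< v+d<n) v (sym (toℕ-fromℕ< v+d<n)))
    where
    v+d<n : toℕ v + d < n
    v+d<n = begin-strict
      toℕ v + d      <⟨ +-monoʳ-< (toℕ v) (n<1+n d) ⟩
      toℕ v + suc d  ≡⟨ v+1+d≡u ⟩
      toℕ u          <⟨ toℕ<n u ⟩
      n              ∎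
      where open ≤-Reasoning
    u≡1+u′ : toℕ u ≡ suc (toℕ (fromℕ< v+d<n))
    u≡1+u′ = trans (sym v+1+d≡u) (trans (+-suc _ _) (cong suc (sym (toℕ-fromℕ< v+d<n))))

  P-connected : Connected (P n)
  P-connected u v with ≤-total (toℕ u) (toℕ v)
  ... | inj₁ u≤v = let (d , u+d≡v) = m≤n⇒∃[o]m+o≡n u≤v in ascend d u v u+d≡v
  ... | inj₂ v≤u = let (d , v+d≡u) = m≤n⇒∃[o]m+o≡n v≤u in descend d u v v+d≡u

  P-tree : Tree n
  P-tree = record { graph = P n ; connected = P-connected ; acyclic = P-acyclic }

lemma4p2 : ∀ (n : ℕ) (T : Tree n) →
    X (P n) ≤ X (graph T) × X (P n) ≡ ceil4 (n * (n ∸ 2))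
lemma4p2 n τ = subst (_≤ X (graph τ)) (sym X-Pₙ) X-τ≥ , X-Pₙ
  where
  X-Pₙ : X (P n) ≡ ceil4 (n * (n ∸ 2))
  X-Pₙ = trans (X-tree (P-tree n) (parity-proper n)) (monochromaticPairs-balanced n parity _ (parity-classes n))
  X-τ≥ : ceil4 (n * (n ∸ 2)) ≤ X (graph τ)
  X-τ≥ with tree-2-colourable τ
  ... | c , proper = subst (ceil4 (n * (n ∸ 2)) ≤_) (sym (X-tree τ proper)) (monochromaticPairs-≥ n c)
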